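{- Let $n=p^a$ with $a\in\mathbb{N}$ and $p$ prime, and let $N_n$ denote the number of different $n\times n$ principal reversible squares. Then \[N_n=\binom{2a-1}{a}.\]
   Context: $\mathbb{N}=\{1,2,3,\dots\}$. A reversible square matrix is an $n\times n$ real matrix $M=(M_{i,j})_{i,j\in\mathbb{Z}_n}$, indices taken in $\mathbb{Z}_n=\mathbb{Z}/n\mathbb{Z}$ with the top left entry having index $(1,1)$, such that (R) $M_{i,j}+M_{i,n+1-j}=M_{i,k}+M_{i,n+1-k}$ and $M_{i,j}+M_{n+1-i,j}=M_{k,j}+M_{n+1-k,j}$ for all $i,j,k\in\mathbb{Z}_n$, and (V) $M_{i,j}+M_{k,l}=M_{i,l}+M_{k,j}$ for all $i,j,k,l\in\mathbb{Z}_n$. An $n\times n$ principal reversible square is a reversible square matrix $M$ with $\{M_{i,j}\}=\{1,2,\dots,n^2\}$, whose entries in each row and in each column appear in increasing order, and with $M_{1,1}=1$, $M_{1,2}=2$. -}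

module Defs where

open import Data.Nat using (ℕ; _+_; _*_; _≤_; _<_)
open import Data.Fin using (Fin; toℕ; opposite)
open import Data.Vec using (Vec; lookup)
open import Data.Product using (_×_; ∃-syntax)
open import Data.List using (List; length)
open import Data.List.Membership.Propositional using (_∈_)
open import Data.List.Relation.Unary.All using (All)
open import Data.List.Relation.Unary.Unique.Propositional using (Unique)
open import Relation.Binary.PropositionalEquality using (_≡_)

-- n × n matrices with natural-number entries (row-major).
-- Index i : Fin n stands for the paper's index toℕ i + 1 ∈ {1,…,n}.
Mat : ℕ → Set
Mat n = Vec (Vec ℕ n) n

entry : ∀ {n} → Mat n → Fin n → Fin n → ℕ
entry M i j = lookup (lookup M i) j

-- The paper's index n+1-j corresponds to  opposite j  (toℕ (opposite j) = n-1-toℕ j).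
-- Condition (R)
CondR : ∀ {n} → Mat n → Set
CondR {n} M =
  (∀ (i j k : Fin n) →
     entry M i j + entry M i (opposite j) ≡ entry M i k + entry M i (opposite k))
  × (∀ (i j k : Fin n) →
     entry M i j + entry M (opposite i) j ≡ entry M k j + entry M (opposite k) j)

CondV : ∀ {n} → Mat n → Set
CondV {n} M =
  ∀ (i j k l : Fin n) → entry M i j + entry M k l ≡ entry M i l + entry M k j

EntriesAre1ton² : ∀ {n} → Mat n → Set
EntriesAre1ton² {n} M =
  (∀ (i j : Fin n) → 1 ≤ entry M i j × entry M i j ≤ n * n)
  × (∀ (v : ℕ) → 1 ≤ v → v ≤ n * n → ∃[ i ] ∃[ j ] entry M i j ≡ v)

Increasing : ∀ {n} → Mat n → Set
Increasing {n} M =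
  (∀ (i j k : Fin n) → toℕ j < toℕ k → entry M i j < entry M i k)
  × (∀ (i j k : Fin n) → toℕ i < toℕ k → entry M i j < entry M k j)

Normalised : ∀ {n} → Mat n → Set
Normalised {n} M =
  ∀ (i j : Fin n) → toℕ i ≡ 0 →
    (toℕ j ≡ 0 → entry M i j ≡ 1) × (toℕ j ≡ 1 → entry M i j ≡ 2)

IsPrincipalReversibleSquare : ∀ {n} → Mat n → Set
IsPrincipalReversibleSquare M =
  CondR M × CondV M × EntriesAre1ton² M × Increasing M × Normalised M

-- "the number of elements of A satisfying P is k": there is a duplicate-free
-- list enumerating exactly the elements satisfying P, of length k.
HasCount : {A : Set} → (A → Set) → ℕ → Set
HasCount {A} P k =
  ∃[ xs ] (Unique xs × All P xs × (∀ (x : A) → P x → x ∈ xs) × length xs ≡ k)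

NumPRS≡ : ℕ → ℕ → Set
NumPRS≡ n k = HasCount (IsPrincipalReversibleSquare {n}) k

{-# OPTIONS --safe #-}
-- By (V) a principal reversible square has entries M i j = r i + c j + 1 with r, c strictly
-- increasing and r 0 = c 0 = 0, and since the entries are exactly 1, …, n², every x < n² is
-- r i + c j for a unique (i, j): (r, c) tiles [0, n²).  For n = p^a these tilings are the digit
-- splittings: a word with a row letters and a column letters distributes the base-p digits of
-- a row index and of a column index over the 2a digit positions.  Indeed, after swapping rows
-- and columns if necessary, c 1 = 1 and m = r 1 is the least nonzero row value; de Bruijn's
-- argument shows that m divides every r i and that the column values come in blocks
-- m q + [0, m), so m ∣ n², hence p ∣ m, and dividing by p leaves a tiling of [0, n²/p) whose
-- refinement by one column digit is (r, c).  Digit splittings satisfy (R) because complementing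
-- every digit of i gives n - 1 - i, and M₁₂ = 2 says that the lowest digit is a column digit;
-- the remaining 2a - 1 positions carry a row letters, giving C(2a - 1, a) squares.
module Submission where

open import Defs
open import Data.Nat
open import Data.Nat.Properties
open import Data.Nat.DivMod
open import Data.Nat.Divisibility
open import Data.Nat.Induction using (<-rec)
open import Data.Nat.Primality using (Prime; prime; prime⇒irreducible; prime⇒nonZero)
open import Data.Nat.Coprimality using (Coprime; coprime-divisor)
open import Data.Nat.Combinatorics using (_C_; nCk+nC[k+1]≡[n+1]C[k+1]; nCk≡nC[n∸k]; nCn≡1)
open import Data.Nat.Tactic.RingSolver using (solve-∀)
open import Data.Bool using (Bool; true; false; not)
open import Data.Fin using (Fin; toℕ; fromℕ<; opposite; combine; remQuot; punchOut)
open import Data.Fin.Properties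
  using (toℕ-fromℕ<; fromℕ<-toℕ; toℕ<n; toℕ-injective; opposite-prop; remQuot-combine; combine-injective;
         punchOut-injective; injective⇒≤)
  renaming (_≟_ to _≟ᶠ_)
open import Data.Vec using (tabulate; lookup)
open import Data.Vec.Properties using (lookup∘tabulate; tabulate∘lookup; tabulate-cong)
open import Data.List using (List; []; _∷_; map; _++_; length)
open import Data.List.Properties using (length-map; length-++; ∷-injectiveʳ)
open import Data.List.Membership.Propositional using (_∈_)
open import Data.List.Membership.Propositional.Properties using (∈-map⁺; ∈-map⁻; ∈-++⁺ˡ; ∈-++⁺ʳ; ∈-++⁻)
open import Data.List.Relation.Unary.Any using (here; there)
open import Data.List.Relation.Unary.All as All using ([]; _∷_)
open import Data.List.Relation.Unary.All.Properties as All using ()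
open import Data.List.Relation.Unary.AllPairs using ([]; _∷_)
open import Data.List.Relation.Unary.Unique.Propositional using (Unique)
open import Data.List.Relation.Unary.Unique.Propositional.Properties as Unique using (++⁺)
open import Data.Empty using (⊥; ⊥-elim)
open import Data.Product using (∃-syntax; _×_; _,_; proj₁; proj₂)
open import Data.Sum using (_⊎_; inj₁; inj₂; [_,_]′)
open import Relation.Nullary using (¬_; yes; no)
open import Relation.Binary.Definitions using (tri<; tri≈; tri>)
open import Relation.Binary.PropositionalEquality

private
  variable
    i i' j j' x : ℕ

module Euclid (p : ℕ) .{{_ : NonZero p}} where

  private
    variable
      q q' t t' : ℕ

  euclid : ∀ x → x ≡ p * (x / p) + x % p
  euclid x = begin
    x                   ≡⟨ m≡m%n+[m/n]*n x p ⟩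
    x % p + x / p * p   ≡⟨ +-comm (x % p) _ ⟩
    x / p * p + x % p   ≡⟨ cong (_+ x % p) (*-comm (x / p) p) ⟩
    p * (x / p) + x % p ∎
    where open ≡-Reasoning

  p*q+t<p*q'+t' : t < p → q < q' → p * q + t < p * q' + t'
  p*q+t<p*q'+t' {t} {q} {q'} {t'} t<p q<q' = begin-strict
    p * q + t   <⟨ +-monoʳ-< (p * q) t<p ⟩
    p * q + p   ≡⟨ trans (+-comm (p * q) p) (sym (*-suc p q)) ⟩
    p * suc q   ≤⟨ *-monoʳ-≤ p q<q' ⟩
    p * q'      ≤⟨ m≤m+n (p * q') t' ⟩
    p * q' + t' ∎
    where open ≤-Reasoning

  p*q+t<p*q'⇒q<q' : p * q + t < p * q' → q < q'
  p*q+t<p*q'⇒q<q' {q} {t} {q'} lt with q <? q'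
  ... | yes q<q' = q<q'
  ... | no q≮q'  = ⊥-elim (<⇒≱ lt (≤-trans (*-monoʳ-≤ p (≮⇒≥ q≮q')) (m≤m+n (p * q) t)))

  quotient-unique : t < p → t' < p → p * q + t ≡ p * q' + t' → q ≡ q'
  quotient-unique {q = q} {q' = q'} t<p t'<p eq with <-cmp q q'
  ... | tri≈ _ q≡q' _ = q≡q'
  ... | tri< q<q' _ _ = ⊥-elim (<⇒≢ (p*q+t<p*q'+t' t<p q<q') eq)
  ... | tri> _ _ q>q' = ⊥-elim (<⇒≢ (p*q+t<p*q'+t' t'<p q>q') (sym eq))

  remainder-unique : t < p → t' < p → p * q + t ≡ p * q' + t' → t ≡ t'
  remainder-unique {t} {t'} {q} t<p t'<p eq with refl ← quotient-unique t<p t'<p eq =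
    +-cancelˡ-≡ (p * q) t t' eq

  [p*q+t]/p≡q : t < p → (p * q + t) / p ≡ q
  [p*q+t]/p≡q {t} {q} t<p = sym (quotient-unique t<p (m%n<n (p * q + t) p) (euclid (p * q + t)))

  [p*q+t]%p≡t : t < p → (p * q + t) % p ≡ t
  [p*q+t]%p≡t {t} {q} t<p = sym (remainder-unique t<p (m%n<n (p * q + t) p) (euclid (p * q + t)))

  p*q/p≡q : ∀ q → p * q / p ≡ q
  p*q/p≡q q = trans (cong (_/ p) (*-comm p q)) (m*n/n≡m q p)

StrictlyIncreasingBelow : ℕ → (ℕ → ℕ) → Set
StrictlyIncreasingBelow n f = ∀ {j j'} → j < j' → j' < n → f j < f j'

Symmetric : ℕ → (ℕ → ℕ) → Set
Symmetric n f = ∀ {i} → i < n → f i + f (n ∸ suc i) ≡ f (n ∸ 1)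

AgreeBelow : ℕ → (ℕ → ℕ) → (ℕ → ℕ) → Set
AgreeBelow n f g = ∀ {i} → i < n → f i ≡ g i

module StrictlyIncreasing {n f} (f-inc : StrictlyIncreasingBelow n f) where

  monotone : j ≤ j' → j' < n → f j ≤ f j'
  monotone j≤j' j'<n with m≤n⇒m<n∨m≡n j≤j'
  ... | inj₁ j<j' = <⇒≤ (f-inc j<j' j'<n)
  ... | inj₂ refl = ≤-refl

  injective : j < n → j' < n → f j ≡ f j' → j ≡ j'
  injective {j} {j'} j<n j'<n eq with <-cmp j j'
  ... | tri≈ _ j≡j' _ = j≡j'
  ... | tri< j<j' _ _ = ⊥-elim (<⇒≢ (f-inc j<j' j'<n) eq)
  ... | tri> _ _ j>j' = ⊥-elim (<⇒≢ (f-inc j>j' j<n) (sym eq))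

  reflects-< : j < n → f j < f j' → j < j'
  reflects-< {j} {j'} j<n lt with j <? j'
  ... | yes j<j' = j<j'
  ... | no j≮j'  = ⊥-elim (<⇒≱ lt (monotone (≮⇒≥ j≮j') j<n))

  successor-≤ : j < n → j' < n → f j < f j' → f (suc j) ≤ f j'
  successor-≤ j<n j'<n lt = monotone (reflects-< j<n lt) j'<n

record Cell (nA nB : ℕ) (r c : ℕ → ℕ) (x : ℕ) : Set where
  constructor cell
  field
    row col : ℕ
    row< : row < nA
    col< : col < nB
    sum≡ : r row + c col ≡ x

record Tiling (nA nB : ℕ) (r c : ℕ → ℕ) : Set where
  field
    r-zero : r 0 ≡ 0
    c-zero : c 0 ≡ 0
    r-increasing : StrictlyIncreasingBelow nA r
    c-increasing : StrictlyIncreasingBelow nB c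
    sum-bounded : i < nA → j < nB → r i + c j < nA * nB
    sum-injective : i < nA → j < nB → i' < nA → j' < nB → r i + c j ≡ r i' + c j' → i ≡ i'
    sum-surjective : x < nA * nB → Cell nA nB r c x

  sum-injectiveʳ : i < nA → j < nB → i' < nA → j' < nB → r i + c j ≡ r i' + c j' → j ≡ j'
  sum-injectiveʳ {i} {j} {i'} {j'} i< j< i'< j'< eq with refl ← sum-injective i< j< i'< j'< eq =
    StrictlyIncreasing.injective c-increasing j< j'< (+-cancelˡ-≡ (r i) (c j) (c j') eq)

swap : ∀ {nA nB r c} → Tiling nA nB r c → Tiling nB nA c r
swap {nA} {nB} {r} {c} T = record
  { r-zero = c-zero
  ; c-zero = r-zero
  ; r-increasing = c-increasing
  ; c-increasing = r-increasing
  ; sum-bounded = λ {j} {i} j< i< → subst₂ _<_ (+-comm (r i) (c j)) (*-comm nA nB) (sum-bounded i< j<)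
  ; sum-injective = λ {j} {i} {j'} {i'} j< i< j'< i'< eq →
      sum-injectiveʳ i< j< i'< j'< (trans (+-comm (r i) (c j)) (trans eq (+-comm (c j') (r i'))))
  ; sum-surjective = λ {x} x< → swapped (sum-surjective (subst (x <_) (*-comm nB nA) x<))
  }
  where
  open Tiling T
  swapped : ∀ {x} → Cell nA nB r c x → Cell nB nA c r x
  swapped (cell i j i< j< eq) = cell j i j< i< (trans (+-comm (c j) (r i)) eq)

record Decomposition (A B : ℕ → Set) (x : ℕ) : Set where
  constructor decomposition
  field
    left right : ℕ
    left∈A : A left
    right∈B : B right
    sum≡ : left + right ≡ x

record DirectSum (A B : ℕ → Set) (N : ℕ) : Set where
  field
    0∈A : A 0
    0∈B : B 0
    sum< : ∀ {a b} → A a → B b → a + b < N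
    unique : ∀ {a b a' b'} → A a → B b → A a' → B b' → a + b ≡ a' + b' → a ≡ a'
    decompose : ∀ {x} → x < N → Decomposition A B x

  determined : ∀ {a b a' b'} → A a → B b → A a' → B b' → a + b ≡ a' + b' → a ≡ a' × b ≡ b'
  determined {a} a∈A b∈B a'∈A b'∈B eq with refl ← unique a∈A b∈B a'∈A b'∈B eq =
    refl , +-cancelˡ-≡ a _ _ eq

-- de Bruijn: if m is the least nonzero element of A, then A ⊆ mℕ, B is a union of
-- translates m·q + [0, m), and m ∣ N.
module Blocks {A B : ℕ → Set} {N : ℕ} (S : DirectSum A B N)
  (m : ℕ) .{{_ : NonZero m}} (m∈A : A m) (m-least : ∀ {a} → A a → a < m → a ≡ 0) where

  private
    variable
      a b k q t u y : ℕ

  open DirectSum S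
  open Euclid m

  BlockInB : ℕ → Set
  BlockInB q = ∀ {t} → t < m → B (m * q + t)

  m<N : m < N
  m<N = subst (_< N) (+-identityʳ m) (sum< m∈A 0∈B)

  below-m⊆B : x < m → B x
  below-m⊆B x<m with decompose (<-trans x<m m<N)
  ... | decomposition a b a∈A b∈B eq = subst B (trans (cong (_+ b) (sym a≡0)) eq) b∈B
    where
    a≡0 : a ≡ 0
    a≡0 = m-least a∈A (≤-<-trans (subst (a ≤_) eq (m≤m+n a b)) x<m)

  Aligned : ℕ → Set
  Aligned y = ∀ {a b} → A a → B b → a + b ≡ y → m ∣ a × BlockInB (b / m)

  aligned-witness : A a → B b → a + b ≡ y → m ∣ a → BlockInB (b / m) → Aligned y
  aligned-witness a∈A b∈B eq m∣a block a'∈A b'∈B eq'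
    with refl , refl ← determined a∈A b∈B a'∈A b'∈B (trans eq (sym eq')) = m∣a , block

  -- For y = m k + r with 0 < r < m, the decomposition of m k shifted by r decomposes y.
  aligned-off-multiple : y % m ≢ 0 → (∀ {z} → z < y → Aligned z) → Aligned y
  aligned-off-multiple {y} r≢0 ih a∈A b∈B eq =
    shift (decompose (<-trans mk<y (subst (_< N) eq (sum< a∈A b∈B)))) a∈A b∈B eq
    where
    r = y % m
    mk<y : m * (y / m) < y
    mk<y = subst (m * (y / m) <_) (sym (euclid y)) (m<m+n (m * (y / m)) (n≢0⇒n>0 r≢0))
    shift : Decomposition A B (m * (y / m)) → Aligned y
    shift (decomposition a b a∈A b∈B eq) =
      aligned-witness a∈A b+r∈B a+[b+r]≡y m∣a (subst BlockInB (sym [b+r]/m≡b/m) block)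
      where
      m∣a : m ∣ a
      m∣a = proj₁ (ih mk<y a∈A b∈B eq)
      block : BlockInB (b / m)
      block = proj₂ (ih mk<y a∈A b∈B eq)
      b≡ : m * (b / m) ≡ b
      b≡ = m*[n/m]≡n (∣m+n∣m⇒∣n (subst (m ∣_) (sym eq) (m∣m*n (y / m))) m∣a)
      b+r∈B : B (b + r)
      b+r∈B = subst B (cong (_+ r) b≡) (block (m%n<n y m))
      [b+r]/m≡b/m : (b + r) / m ≡ b / m
      [b+r]/m≡b/m = trans (cong (λ z → (z + r) / m) (sym b≡)) ([p*q+t]/p≡q (m%n<n y m))
      a+[b+r]≡y : a + (b + r) ≡ y
      a+[b+r]≡y = begin
        a + (b + r)     ≡⟨ +-assoc a b r ⟨
        a + b + r       ≡⟨ cong (_+ r) eq ⟩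
        m * (y / m) + r ≡⟨ euclid y ⟨
        y               ∎
        where open ≡-Reasoning

  above-multiple-impossible : B (m * k) → A (m * k + u) → 0 < u → u < m → ⊥
  above-multiple-impossible {k} {u} mk∈B a∈A 0<u u<m = <⇒≢ 0<u u≡0
    where
    m≡mk+u : m ≡ m * k + u
    m≡mk+u = unique m∈A mk∈B a∈A (below-m⊆B (∸-monoʳ-< 0<u (<⇒≤ u<m))) (begin
      m + m * k             ≡⟨ +-comm m (m * k) ⟩
      m * k + m             ≡⟨ cong (m * k +_) (m+[n∸m]≡n (<⇒≤ u<m)) ⟨
      m * k + (u + (m ∸ u)) ≡⟨ +-assoc (m * k) u (m ∸ u) ⟨
      m * k + u + (m ∸ u)   ∎)
      where open ≡-Reasoning
    u≡0 : 0 ≡ u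
    u≡0 = remainder-unique (>-nonZero⁻¹ m) u<m (trans (trans (+-identityʳ (m * 1)) (*-identityʳ m)) m≡mk+u)

  multiple-summand-zero : (∀ {z} → z < m * k → Aligned z) → B (m * k) → t < m →
                          A a → B b → a + b ≡ m * k + t → a ≡ 0
  multiple-summand-zero {k} {t} {a} {b} ih mk∈B t<m a∈A b∈B eq with m * k ≤? b | a <? m * k
  ... | yes mk≤b | _ = m-least a∈A (≤-<-trans a≤t t<m)
    where
    a≤t : a ≤ t
    a≤t = +-cancelʳ-≤ (m * k) a t (≤-trans (+-monoʳ-≤ a mk≤b) (≤-reflexive (trans eq (+-comm (m * k) t))))
  ... | no mk≰b | yes a<mk = unique a∈A (block (>-nonZero⁻¹ m)) 0∈A mk∈B a+mβ≡mk
    where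
    α = a / m
    β = b / m
    block : BlockInB β
    block = proj₂ (ih (≰⇒> mk≰b) 0∈A b∈B refl)
    a≡ : m * α ≡ a
    a≡ = m*[n/m]≡n (proj₁ (ih a<mk a∈A 0∈B (+-identityʳ a)))
    α+β≡k : α + β ≡ k
    α+β≡k = quotient-unique (m%n<n b m) t<m (begin
      m * (α + β) + b % m     ≡⟨ cong (_+ b % m) (*-distribˡ-+ m α β) ⟩
      m * α + m * β + b % m   ≡⟨ +-assoc (m * α) (m * β) (b % m) ⟩
      m * α + (m * β + b % m) ≡⟨ cong₂ _+_ a≡ (sym (euclid b)) ⟩
      a + b                   ≡⟨ eq ⟩
      m * k + t               ∎)
      where open ≡-Reasoning
    a+mβ≡mk : a + (m * β + 0) ≡ m * k
    a+mβ≡mk = begin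
      a + (m * β + 0)   ≡⟨ cong₂ _+_ (sym a≡) (+-identityʳ (m * β)) ⟩
      m * α + m * β     ≡⟨ *-distribˡ-+ m α β ⟨
      m * (α + β)       ≡⟨ cong (m *_) α+β≡k ⟩
      m * k             ∎
      where open ≡-Reasoning
  ... | no mk≰b | no a≮mk with a ∸ m * k ≟ 0
  ...   | yes u≡0 = unique a∈A 0∈B 0∈A mk∈B
    (trans (+-identityʳ a) (trans (sym (m+[n∸m]≡n mk≤a)) (trans (cong (m * k +_) u≡0) (+-identityʳ (m * k)))))
    where
    mk≤a : m * k ≤ a
    mk≤a = ≮⇒≥ a≮mk
  ...   | no u≢0 =
    ⊥-elim (above-multiple-impossible mk∈B (subst A (sym (m+[n∸m]≡n mk≤a)) a∈A) (n≢0⇒n>0 u≢0) (≤-<-trans u≤t t<m))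
    where
    mk≤a : m * k ≤ a
    mk≤a = ≮⇒≥ a≮mk
    u≤t : a ∸ m * k ≤ t
    u≤t = +-cancelˡ-≤ (m * k) (a ∸ m * k) t (≤-trans (m≤m+n _ b)
            (≤-reflexive (trans (cong (_+ b) (m+[n∸m]≡n mk≤a)) eq)))

  block-of-multiple : (∀ {z} → z < m * k → Aligned z) → B (m * k) → BlockInB k
  block-of-multiple {k} ih mk∈B {t} t<m with decompose (≤-<-trans mk+t≤m+mk (sum< m∈A mk∈B))
    where
    mk+t≤m+mk : m * k + t ≤ m + m * k
    mk+t≤m+mk = ≤-trans (+-monoʳ-≤ (m * k) (<⇒≤ t<m)) (≤-reflexive (+-comm (m * k) m))
  ... | decomposition a b a∈A b∈B eq =
    subst B (trans (cong (_+ b) (sym (multiple-summand-zero ih mk∈B t<m a∈A b∈B eq))) eq) b∈B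

  block-zero : BlockInB 0
  block-zero {t} t<m = subst B (sym (cong (_+ t) (*-zeroʳ m))) (below-m⊆B t<m)

  aligned-at-multiple : (∀ {z} → z < m * k → Aligned z) → Aligned (m * k)
  aligned-at-multiple {k} ih {a} {b} a∈A b∈B eq with a ≟ 0 | b ≟ 0
  ... | yes refl | _ =
    m ∣0 , subst BlockInB (sym (trans (cong (_/ m) eq) (p*q/p≡q k))) (block-of-multiple ih (subst B eq b∈B))
  ... | no _ | yes refl =
    subst (m ∣_) (trans (sym eq) (+-identityʳ a)) (m∣m*n k) , subst BlockInB (sym (0/n≡0 m)) block-zero
  ... | no a≢0 | no b≢0 =
    proj₁ (ih a<mk a∈A 0∈B (+-identityʳ a)) , proj₂ (ih b<mk 0∈A b∈B refl)
    where
    a<mk : a < m * k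
    a<mk = subst (a <_) eq (m<m+n a (n≢0⇒n>0 b≢0))
    b<mk : b < m * k
    b<mk = subst (b <_) eq (m<n+m b (n≢0⇒n>0 a≢0))

  aligned : ∀ y → Aligned y
  aligned = <-rec Aligned step
    where
    step : ∀ y → (∀ {z} → z < y → Aligned z) → Aligned y
    step y ih with y % m ≟ 0
    ... | no r≢0 = aligned-off-multiple r≢0 ih
    ... | yes r≡0 = subst Aligned (sym y≡mk) (aligned-at-multiple (λ z< → ih (subst (_ <_) (sym y≡mk) z<)))
      where
      y≡mk : y ≡ m * (y / m)
      y≡mk = trans (euclid y) (trans (cong (m * (y / m) +_) r≡0) (+-identityʳ _))

  m∣A : A a → m ∣ a
  m∣A {a} a∈A = proj₁ (aligned a a∈A 0∈B (+-identityʳ a))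

  B-blocks : t < m → B (m * q + t) → BlockInB q
  B-blocks t<m b∈B = subst BlockInB ([p*q+t]/p≡q t<m) (proj₂ (aligned _ 0∈A b∈B refl))

  m∣N : m ∣ N
  m∣N = from-decomposition (decompose (subst (pred N <_) (suc-pred N) (n<1+n (pred N))))
    where
    instance
      N≢0 : NonZero N
      N≢0 = >-nonZero (<-trans (>-nonZero⁻¹ m) m<N)
    from-decomposition : Decomposition A B (pred N) → m ∣ N
    from-decomposition (decomposition a b a∈A b∈B eq) = divides (α + β + 1) N≡
      where
      α = a / m
      β = b / m
      a≡ : m * α ≡ a
      a≡ = m*[n/m]≡n (proj₁ (aligned (pred N) a∈A b∈B eq))
      top∈B : B (m * β + pred m)
      top∈B = proj₂ (aligned (pred N) a∈A b∈B eq) (subst (pred m <_) (suc-pred m) (n<1+n (pred m)))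
      ρ≡ : b % m ≡ pred m
      ρ≡ = ≤-antisym (<⇒≤pred (m%n<n b m)) (+-cancelˡ-≤ (a + m * β) (pred m) (b % m) (begin
        a + m * β + pred m   ≡⟨ +-assoc a (m * β) (pred m) ⟩
        a + (m * β + pred m) ≤⟨ <⇒≤pred (subst (a + (m * β + pred m) <_) (sym (suc-pred N)) (sum< a∈A top∈B)) ⟩
        pred N               ≡⟨ eq ⟨
        a + b                ≡⟨ cong (a +_) (euclid b) ⟩
        a + (m * β + b % m)  ≡⟨ +-assoc a (m * β) (b % m) ⟨
        a + m * β + b % m    ∎))
        where open ≤-Reasoning
      N≡ : N ≡ (α + β + 1) * m
      N≡ = begin
        N
          ≡⟨ trans (cong suc eq) (suc-pred N) ⟨
        suc (a + b)
          ≡⟨ cong suc (cong₂ _+_ a≡ (sym (trans (euclid b) (cong (m * β +_) ρ≡)))) ⟨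
        suc (m * α + (m * β + pred m))
          ≡⟨ cong (λ z → suc (z * α + (z * β + pred m))) (suc-pred m) ⟨
        suc (suc (pred m) * α + (suc (pred m) * β + pred m))
          ≡⟨ ring α β (pred m) ⟩
        (α + β + 1) * suc (pred m)
          ≡⟨ cong ((α + β + 1) *_) (suc-pred m) ⟩
        (α + β + 1) * m
          ∎
        where
        open ≡-Reasoning
        ring : ∀ x y w → suc (suc w * x + (suc w * y + w)) ≡ (x + y + 1) * suc w
        ring = solve-∀

∣p^k∧≢1⇒p∣ : ∀ {p d} → Prime p → ∀ k → d ∣ p ^ k → d ≢ 1 → p ∣ d
∣p^k∧≢1⇒p∣ pr zero d∣1 d≢1 = ⊥-elim (d≢1 (∣1⇒≡1 d∣1))
∣p^k∧≢1⇒p∣ {p} {d} pr (suc k) d∣p^k d≢1 with p ∣? d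
... | yes p∣d = p∣d
... | no p∤d = ∣p^k∧≢1⇒p∣ pr k (coprime-divisor d⊥p d∣p^k) d≢1
  where
  d⊥p : Coprime d p
  d⊥p (e∣d , e∣p) with prime⇒irreducible pr e∣p
  ... | inj₁ e≡1 = e≡1
  ... | inj₂ refl = ⊥-elim (p∤d e∣d)

Image : ℕ → (ℕ → ℕ) → ℕ → Set
Image n f x = ∃[ j ] j < n × f j ≡ x

directSum : ∀ {nA nB r c} → Tiling nA nB r c → 0 < nA → 0 < nB →
            DirectSum (Image nA r) (Image nB c) (nA * nB)
directSum {nA} {nB} {r} {c} T 0<nA 0<nB = record
  { 0∈A = 0 , 0<nA , r-zero
  ; 0∈B = 0 , 0<nB , c-zero
  ; sum< = λ { (i , i< , refl) (j , j< , refl) → sum-bounded i< j< }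
  ; unique = λ { (i , i< , refl) (j , j< , refl) (i' , i'< , refl) (j' , j'< , refl) eq →
                 cong r (sum-injective i< j< i'< j'< eq) }
  ; decompose = λ x< → images (sum-surjective x<)
  }
  where
  open Tiling T
  images : ∀ {x} → Cell nA nB r c x → Decomposition (Image nA r) (Image nB c) x
  images (cell i j i< j< eq) = decomposition (r i) (c j) (i , i< , refl) (j , j< , refl) eq

DigitClosed : ℕ → ℕ → (ℕ → ℕ) → Set
DigitClosed p n c = ∀ {Q t t'} → t < p → t' < p → Image n c (p * Q + t) → Image n c (p * Q + t')

module Quotient (p : ℕ) .{{_ : NonZero p}} {nA M r c} (T : Tiling nA (p * M) r c)
  (p∣r : ∀ {i} → i < nA → p ∣ r i) (closed : DigitClosed p (p * M) c) where

  private
    variable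
      q s t Q : ℕ

  open Tiling T
  open Euclid p
  open StrictlyIncreasing c-increasing using (successor-≤)

  next-digit : suc t < p → suc j < p * M → c j ≡ p * Q + t → c (suc j) ≡ p * Q + suc t
  next-digit {t} {j} {Q} st<p sj< cj≡ = ≤-antisym (below-image (closed t<p st<p (j , j< , cj≡))) above
    where
    t<p : t < p
    t<p = <-trans (n<1+n t) st<p
    j< : j < p * M
    j< = <-trans (n<1+n j) sj<
    below-image : Image (p * M) c (p * Q + suc t) → c (suc j) ≤ p * Q + suc t
    below-image (k , k< , ck≡) = subst (c (suc j) ≤_) ck≡
      (successor-≤ j< k< (subst₂ _<_ (sym cj≡) (sym ck≡) (+-monoʳ-< (p * Q) (n<1+n t))))
    above : p * Q + suc t ≤ c (suc j)
    above = subst (_≤ c (suc j)) (sym (+-suc (p * Q) t)) (subst (_< c (suc j)) cj≡ (c-increasing (n<1+n j) sj<))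

  pred<p : pred p < p
  pred<p = subst (pred p <_) (suc-pred p) (n<1+n (pred p))

  no-carry-impossible : suc j < p * M → c j ≡ p * Q + pred p → c (suc j) % p ≡ suc s → ⊥
  no-carry-impossible {j} {Q} {s} sj< cj≡ rem = [ below-prev , equal-prev ]′ (m≤n⇒m<n∨m≡n cj≤prev)
    where
    y = c (suc j)
    X = y / p
    y≡ : y ≡ p * X + suc s
    y≡ = trans (euclid y) (cong (p * X +_) rem)
    s+1<p : suc s < p
    s+1<p = subst (_< p) rem (m%n<n y p)
    s<p : s < p
    s<p = <-trans (n<1+n s) s+1<p
    cj≤prev : c j ≤ p * X + s
    cj≤prev = ≤-pred (subst (c j <_) (trans y≡ (+-suc (p * X) s)) (c-increasing (n<1+n j) sj<))
    below-prev : c j < p * X + s → ⊥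
    below-prev cj<prev = image-above (closed s+1<p s<p (suc j , sj< , y≡))
      where
      image-above : Image (p * M) c (p * X + s) → ⊥
      image-above (k , k< , ck≡) = <⇒≱ prev<y y≤prev
        where
        y≤prev : y ≤ p * X + s
        y≤prev = subst (y ≤_) ck≡ (successor-≤ (<-trans (n<1+n j) sj<) k< (subst (c j <_) (sym ck≡) cj<prev))
        prev<y : p * X + s < y
        prev<y = subst (p * X + s <_) (sym y≡) (+-monoʳ-< (p * X) (n<1+n s))
    equal-prev : c j ≡ p * X + s → ⊥
    equal-prev cj≡prev = <-irrefl (suc-pred p) (subst (λ z → suc z < p) (sym pred≡s) s+1<p)
      where
      pred≡s : pred p ≡ s
      pred≡s = remainder-unique pred<p s<p (trans (sym cj≡) cj≡prev)

  carry : suc j < p * M → c j ≡ p * Q + pred p → p ∣ c (suc j)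
  carry sj< cj≡ with c (suc _) % p in rem
  ... | zero = m%n≡0⇒n∣m _ p rem
  ... | suc _ = ⊥-elim (no-carry-impossible sj< cj≡ rem)

  within-block : c (p * q) ≡ p * Q → ∀ t → t < p → p * q + t < p * M → c (p * q + t) ≡ p * Q + t
  within-block {q} {Q} cpq≡ zero _ _ = trans (cong c (+-identityʳ (p * q))) (trans cpq≡ (sym (+-identityʳ (p * Q))))
  within-block {q} {Q} cpq≡ (suc t) t+1<p lt =
    trans (cong c (+-suc (p * q) t)) (next-digit t+1<p (subst (_< p * M) (+-suc (p * q) t) lt)
      (within-block cpq≡ t (<-trans (n<1+n t) t+1<p) (≤-<-trans (+-monoʳ-≤ (p * q) (n≤1+n t)) lt)))

  block-start : ∀ q → p * q < p * M → p ∣ c (p * q)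
  block-start zero _ = subst (p ∣_) (sym (trans (cong c (*-zeroʳ p)) c-zero)) (p ∣0)
  block-start (suc q) lt = subst (p ∣_) (cong c last+1≡)
    (carry (subst (_< p * M) (sym last+1≡) lt)
      (within-block (sym (m*[n/m]≡n (block-start q pq<))) (pred p) pred<p (<-trans (n<1+n _) (subst (_< p * M) (sym last+1≡) lt))))
    where
    last+1≡ : suc (p * q + pred p) ≡ p * suc q
    last+1≡ = begin
      suc (p * q + pred p) ≡⟨ +-suc (p * q) (pred p) ⟨
      p * q + suc (pred p) ≡⟨ cong (p * q +_) (suc-pred p) ⟩
      p * q + p           ≡⟨ +-comm (p * q) p ⟩
      p + p * q           ≡⟨ *-suc p q ⟨
      p * suc q           ∎
      where open ≡-Reasoning
    pq< : p * q < p * M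
    pq< = <-trans (*-monoʳ-< p (n<1+n q)) lt

  r' c' : ℕ → ℕ
  r' i = r i / p
  c' q = c (p * q) / p

  r≡ : i < nA → r i ≡ p * r' i
  r≡ i< = sym (m*[n/m]≡n (p∣r i<))

  c-block-start : p * q < p * M → c (p * q) ≡ p * c' q
  c-block-start {q} lt = sym (m*[n/m]≡n (block-start q lt))

  c≡ : j < p * M → c j ≡ p * c' (j / p) + j % p
  c≡ {j} j< = begin
    c j                              ≡⟨ cong c (euclid j) ⟩
    c (p * (j / p) + j % p)          ≡⟨ within-block (c-block-start pq<) (j % p) (m%n<n j p) (subst (_< p * M) (euclid j) j<) ⟩
    p * c' (j / p) + j % p           ∎
    where
    open ≡-Reasoning
    pq< : p * (j / p) < p * M
    pq< = ≤-<-trans (m≤m+n _ (j % p)) (subst (_< p * M) (euclid j) j<)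

  quotient-tiling : Tiling nA M r' c'
  quotient-tiling = record
    { r-zero = trans (cong (_/ p) r-zero) (0/n≡0 p)
    ; c-zero = trans (cong (λ z → c z / p) (*-zeroʳ p)) (trans (cong (_/ p) c-zero) (0/n≡0 p))
    ; r-increasing = λ i<i' i'< → *-cancelˡ-< p _ _
        (subst₂ _<_ (r≡ (<-trans i<i' i'<)) (r≡ i'<) (r-increasing i<i' i'<))
    ; c-increasing = λ q<q' q'< → *-cancelˡ-< p _ _
        (subst₂ _<_ (c-block-start (p*< (<-trans q<q' q'<))) (c-block-start (p*< q'<)) (c-increasing (*-monoʳ-< p q<q') (p*< q'<)))
    ; sum-bounded = bounded
    ; sum-injective = λ i< q< i'< q'< eq → sum-injective i< (p*< q<) i'< (p*< q'<) (begin
        r _ + c (p * _)        ≡⟨ cong₂ _+_ (r≡ i<) (c-block-start (p*< q<)) ⟩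
        p * r' _ + p * c' _    ≡⟨ *-distribˡ-+ p _ _ ⟨
        p * (r' _ + c' _)      ≡⟨ cong (p *_) eq ⟩
        p * (r' _ + c' _)      ≡⟨ *-distribˡ-+ p _ _ ⟩
        p * r' _ + p * c' _    ≡⟨ cong₂ _+_ (r≡ i'<) (c-block-start (p*< q'<)) ⟨
        r _ + c (p * _)        ∎)
    ; sum-surjective = surjective
    }
    where
    open ≡-Reasoning
    p*< : q < M → p * q < p * M
    p*< = *-monoʳ-< p
    p*[nA*M] : nA * (p * M) ≡ p * (nA * M)
    p*[nA*M] = ring nA p M
      where
      ring : ∀ a b c → a * (b * c) ≡ b * (a * c)
      ring = solve-∀
    bounded : i < nA → q < M → r' i + c' q < nA * M
    bounded {i} {q} i< q< = p*q+t<p*q'⇒q<q' (subst₂ _<_ lhs≡ p*[nA*M] (sum-bounded i< last<))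
      where
      last< : p * q + pred p < p * M
      last< = subst (p * q + pred p <_) (+-identityʳ (p * M)) (p*q+t<p*q'+t' pred<p q<)
      lhs≡ : r i + c (p * q + pred p) ≡ p * (r' i + c' q) + pred p
      lhs≡ = begin
        r i + c (p * q + pred p)           ≡⟨ cong₂ _+_ (r≡ i<) (within-block (c-block-start (p*< q<)) (pred p) pred<p last<) ⟩
        p * r' i + (p * c' q + pred p)     ≡⟨ +-assoc (p * r' i) (p * c' q) (pred p) ⟨
        p * r' i + p * c' q + pred p       ≡⟨ cong (_+ pred p) (*-distribˡ-+ p (r' i) (c' q)) ⟨
        p * (r' i + c' q) + pred p         ∎
    surjective : ∀ {x} → x < nA * M → Cell nA M r' c' x
    surjective {x} x< with sum-surjective (subst (p * x <_) (sym p*[nA*M]) (*-monoʳ-< p x<))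
    ... | cell i j i< j< eq = cell i (j / p) i< (m<n*o⇒m/o<n (subst (j <_) (*-comm p M) j<))
      (quotient-unique (m%n<n j p) (>-nonZero⁻¹ p) (begin
        p * (r' i + c' (j / p)) + j % p    ≡⟨ cong (_+ j % p) (*-distribˡ-+ p (r' i) (c' (j / p))) ⟩
        p * r' i + p * c' (j / p) + j % p  ≡⟨ +-assoc (p * r' i) _ (j % p) ⟩
        p * r' i + (p * c' (j / p) + j % p) ≡⟨ cong₂ _+_ (r≡ i<) (c≡ j<) ⟨
        r i + c j                          ≡⟨ eq ⟩
        p * x                              ≡⟨ +-identityʳ (p * x) ⟨
        p * x + 0                          ∎))

1<p*p^ : ∀ {p} → 1 < p → ∀ k → 1 < p * p ^ k
1<p*p^ {p} 1<p k = ≤-trans 1<p (subst (_≤ p * p ^ k) (*-identityʳ p) (*-monoʳ-≤ p (m^n>0 p k)))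
  where
  instance
    p≢0 : NonZero p
    p≢0 = >-nonZero (<-trans z<s 1<p)

prime>1 : ∀ {p} → Prime p → 1 < p
prime>1 {p} (prime _) = nonTrivial⇒n>1 p

module PrimePower (p : ℕ) (p-prime : Prime p) where

  private
    variable
      s t : ℕ
      r c : ℕ → ℕ

  instance
    p≢0 : NonZero p
    p≢0 = prime⇒nonZero p-prime

  1<p : 1 < p
  1<p = prime>1 p-prime

  open Euclid p

  record ColumnRefinement (s t : ℕ) (r c : ℕ → ℕ) : Set where
    field
      r' c' : ℕ → ℕ
      tiling : Tiling (p ^ s) (p ^ t) r' c'
      r≡ : ∀ {i} → i < p ^ s → r i ≡ p * r' i
      c≡ : ∀ {j} → j < p ^ suc t → c j ≡ p * c' (j / p) + j % p

  quotient-refinement : Tiling (p ^ s) (p * p ^ t) r c → (∀ {i} → i < p ^ s → p ∣ r i) →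
                        DigitClosed p (p * p ^ t) c → ColumnRefinement s t r c
  quotient-refinement T p∣r closed =
    record { r' = r' ; c' = c' ; tiling = quotient-tiling ; r≡ = r≡ ; c≡ = c≡ }
    where open Quotient p T p∣r closed

  single-row-refinement : Tiling 1 (p * p ^ t) r c → ColumnRefinement 0 t r c
  single-row-refinement {t} {r} {c} T = quotient-refinement T p∣r closed
    where
    open Tiling T
    r≡0 : i < 1 → r i ≡ 0
    r≡0 {zero} _ = r-zero
    r≡0 {suc _} (s<s ())
    p∣r : i < 1 → p ∣ r i
    p∣r i<1 = subst (p ∣_) (sym (r≡0 i<1)) (p ∣0)
    image : ∀ {x} → x < p * p ^ t → Image (p * p ^ t) c x
    image {x} x< with sum-surjective (subst (x <_) (sym (*-identityˡ _)) x<)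
    ... | cell i j i< j< eq = j , j< , trans (cong (_+ c j) (sym (r≡0 i<))) eq
    closed : DigitClosed p (p * p ^ t) c
    closed {Q} {u} {u'} u<p u'<p (j , j< , cj≡) = image (subst (p * Q + u' <_) (+-identityʳ _) (p*q+t<p*q'+t' u'<p Q<))
      where
      Q< : Q < p ^ t
      Q< = p*q+t<p*q'⇒q<q' (subst₂ _<_ (trans (cong (_+ c j) r-zero) cj≡) (*-identityˡ _) (sum-bounded {0} z<s j<))

  -- With c 1 = 1, the least nonzero r-value m = r 1 exceeds 1, so de Bruijn's lemma applies;
  -- m ∣ p^(s+t) then forces p ∣ m.
  refinement-when-c1≡1 : Tiling (p ^ suc s) (p * p ^ t) r c → c 1 ≡ 1 → ColumnRefinement (suc s) t r c
  refinement-when-c1≡1 {s} {t} {r} {c} T c1≡1 = quotient-refinement T p∣r closed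
    where
    open Tiling T
    nA = p ^ suc s
    nB = p * p ^ t
    m = r 1
    1<nA : 1 < nA
    1<nA = 1<p*p^ 1<p s
    0<nB : 0 < nB
    0<nB = <-trans z<s (1<p*p^ 1<p t)
    m≢1 : m ≢ 1
    m≢1 m≡1 = 1+n≢0 (sum-injective 1<nA 0<nB (<-trans z<s 1<nA) (1<p*p^ 1<p t)
      (trans (cong₂ _+_ m≡1 c-zero) (cong₂ _+_ (sym r-zero) (sym c1≡1))))
    1<m : 1 < m
    1<m = ≤∧≢⇒< (subst (_< m) r-zero (r-increasing z<s 1<nA)) (λ 1≡m → m≢1 (sym 1≡m))
    instance
      m≢0 : NonZero m
      m≢0 = >-nonZero (<-trans z<s 1<m)
    m-least : ∀ {a} → Image nA r a → a < m → a ≡ 0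
    m-least (zero , _ , refl) _ = r-zero
    m-least (suc i , i< , refl) a<m = ⊥-elim (<⇒≱ a<m (StrictlyIncreasing.monotone r-increasing (s≤s z≤n) i<))
    open Blocks (directSum T (<-trans z<s 1<nA) 0<nB) m (1 , 1<nA , refl) m-least
    p∣m : p ∣ m
    p∣m = ∣p^k∧≢1⇒p∣ p-prime (suc s + suc t) (subst (m ∣_) (sym (^-distribˡ-+-* p (suc s) (suc t))) m∣N) m≢1
    p∣r : i < nA → p ∣ r i
    p∣r i< = ∣-trans p∣m (m∣A (_ , i< , refl))
    k = m / p
    m≡pk : m ≡ p * k
    m≡pk = sym (m*[n/m]≡n p∣m)
    instance
      k≢0 : NonZero k
      k≢0 = ≢-nonZero λ k≡0 → <⇒≢ (<-trans z<s 1<m) (sym (trans m≡pk (trans (cong (p *_) k≡0) (*-zeroʳ p))))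
    closed : DigitClosed p nB c
    closed {Q} {u} {u'} u<p u'<p x∈B =
      subst (Image nB c) (sym (regroup u')) (B-blocks (in-block u<p) (subst (Image nB c) (regroup u) x∈B) (in-block u'<p))
      where
      regroup : ∀ v → p * Q + v ≡ m * (Q / k) + (p * (Q % k) + v)
      regroup v = begin
        p * Q + v                          ≡⟨ cong (λ z → p * z + v) (m≡m%n+[m/n]*n Q k) ⟩
        p * (Q % k + Q / k * k) + v        ≡⟨ ring p k (Q / k) (Q % k) v ⟩
        p * k * (Q / k) + (p * (Q % k) + v) ≡⟨ cong (λ z → z * (Q / k) + (p * (Q % k) + v)) (sym m≡pk) ⟩
        m * (Q / k) + (p * (Q % k) + v)    ∎
        where
        open ≡-Reasoning
        ring : ∀ p k q r v → p * (r + q * k) + v ≡ p * k * q + (p * r + v)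
        ring = solve-∀
      in-block : ∀ {v} → v < p → p * (Q % k) + v < m
      in-block {v} v<p = subst (p * (Q % k) + v <_) (trans (+-identityʳ _) (sym m≡pk)) (p*q+t<p*q'+t' v<p (m%n<n Q k))

  column-refinement : Tiling (p ^ s) (p ^ suc t) r c → c 1 ≡ 1 → ColumnRefinement s t r c
  column-refinement {zero} T _ = single-row-refinement T
  column-refinement {suc s} T c1≡1 = refinement-when-c1≡1 T c1≡1

count : Bool → List Bool → ℕ
count b [] = 0
count true (true ∷ σ) = suc (count true σ)
count true (false ∷ σ) = count true σ
count false (false ∷ σ) = suc (count false σ)
count false (true ∷ σ) = count false σ

flip : List Bool → List Bool
flip = map not

count-flip : ∀ b σ → count b (flip σ) ≡ count (not b) σ
count-flip b [] = refl
count-flip true (true ∷ σ) = count-flip true σ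
count-flip true (false ∷ σ) = cong suc (count-flip true σ)
count-flip false (true ∷ σ) = cong suc (count-flip false σ)
count-flip false (false ∷ σ) = count-flip false σ

module Words (p : ℕ) .{{_ : NonZero p}} where

  -- A word σ ∈ {true, false}* assigns the base-p digit positions (least significant first)
  -- to the rows (true) or the columns (false); scatter b σ i writes the digits of i into
  -- the positions labelled b, and zeroes in the others.
  refine scale : (ℕ → ℕ) → ℕ → ℕ
  refine g j = p * g (j / p) + j % p
  scale g j = p * g j

  scatter : Bool → List Bool → ℕ → ℕ
  scatter b [] = λ i → i
  scatter true (true ∷ σ) = refine (scatter true σ)
  scatter true (false ∷ σ) = scale (scatter true σ)
  scatter false (false ∷ σ) = refine (scatter false σ)
  scatter false (true ∷ σ) = scale (scatter false σ)

  scatter-flip : ∀ b σ i → scatter b (flip σ) i ≡ scatter (not b) σ i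
  scatter-flip b [] i = refl
  scatter-flip true (true ∷ σ) i = cong (p *_) (scatter-flip true σ i)
  scatter-flip true (false ∷ σ) i = cong (λ z → p * z + i % p) (scatter-flip true σ (i / p))
  scatter-flip false (true ∷ σ) i = cong (λ z → p * z + i % p) (scatter-flip false σ (i / p))
  scatter-flip false (false ∷ σ) i = cong (p *_) (scatter-flip false σ i)

  record FromWord (s t : ℕ) (r c : ℕ → ℕ) : Set where
    field
      word : List Bool
      #rows : count true word ≡ s
      #cols : count false word ≡ t
      r≡ : ∀ {i} → i < p ^ s → r i ≡ scatter true word i
      c≡ : ∀ {j} → j < p ^ t → c j ≡ scatter false word j

  fromWord-swap : ∀ {s t r c} → FromWord t s c r → FromWord s t r c
  fromWord-swap F = record
    { word = flip word
    ; #rows = trans (count-flip true word) #cols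
    ; #cols = trans (count-flip false word) #rows
    ; r≡ = λ {i} i< → trans (c≡ i<) (sym (scatter-flip true word i))
    ; c≡ = λ {j} j< → trans (r≡ j<) (sym (scatter-flip false word j))
    }
    where open FromWord F

increasing-hits-one : ∀ {n f j} → StrictlyIncreasingBelow n f → f 0 ≡ 0 → j < n → f j ≡ 1 → 1 < n × f 1 ≡ 1
increasing-hits-one {j = zero} f-inc f0≡0 _ fj≡1 = ⊥-elim (0≢1+n (trans (sym f0≡0) fj≡1))
increasing-hits-one {n} {f} {suc j} f-inc f0≡0 j< fj≡1 =
  1<n , ≤-antisym (subst (f 1 ≤_) fj≡1 (StrictlyIncreasing.monotone f-inc (s≤s z≤n) j<)) (subst (_< f 1) f0≡0 (f-inc z<s 1<n))
  where
  1<n : 1 < n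
  1<n = ≤-<-trans (s≤s z≤n) j<

one-at-row-or-column : ∀ {nA nB r c} → Tiling nA nB r c → 1 < nA * nB → (1 < nA × r 1 ≡ 1) ⊎ (1 < nB × c 1 ≡ 1)
one-at-row-or-column {r = r} T 1<N with Tiling.sum-surjective T 1<N
... | cell i j i< j< eq with r i in ri≡
...   | zero = inj₂ (increasing-hits-one (Tiling.c-increasing T) (Tiling.c-zero T) j< eq)
...   | suc zero = inj₁ (increasing-hits-one (Tiling.r-increasing T) (Tiling.r-zero T) i< ri≡)
...   | suc (suc _) = ⊥-elim (1+n≢0 (suc-injective eq))

module Classification (p : ℕ) (p-prime : Prime p) where

  open PrimePower p p-prime
  open Words p

  Classifiable : ℕ → Set
  Classifiable K = ∀ {s t r c} → s + t ≡ K → Tiling (p ^ s) (p ^ t) r c → FromWord s t r c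

  by-column : ∀ {K s t r c} → Classifiable K → s + t ≡ suc K → Tiling (p ^ s) (p ^ t) r c →
              1 < p ^ t → c 1 ≡ 1 → FromWord s t r c
  by-column {t = zero} _ _ _ (s<s ())
  by-column {s = s} {suc t} {r} {c} classify eq T _ c1≡1 = record
    { word = false ∷ word
    ; #rows = #rows
    ; #cols = cong suc #cols
    ; r≡ = λ i< → trans (R.r≡ i<) (cong (p *_) (r≡ i<))
    ; c≡ = λ {j} j< → trans (R.c≡ j<) (cong (λ z → p * z + j % p) (c≡ (m<n*o⇒m/o<n (subst (j <_) (*-comm p (p ^ t)) j<))))
    }
    where
    module R = ColumnRefinement (column-refinement {s} {t} T c1≡1)
    open FromWord (classify {s} {t} (suc-injective (trans (sym (+-suc s t)) eq)) R.tiling)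

  classify : ∀ K → Classifiable K
  classify zero {zero} {zero} {r} {c} refl T = record
    { word = [] ; #rows = refl ; #cols = refl ; r≡ = below-one {r} r-zero ; c≡ = below-one {c} c-zero }
    where
    open Tiling T
    below-one : ∀ {f : ℕ → ℕ} → f 0 ≡ 0 → ∀ {i} → i < 1 → f i ≡ i
    below-one f0≡0 {zero} _ = f0≡0
    below-one f0≡0 {suc _} (s<s ())
  classify (suc K) {s} {t} eq T with one-at-row-or-column T 1<N
    where
    1<N : 1 < p ^ s * p ^ t
    1<N = subst (1 <_) (trans (cong (p ^_) (sym eq)) (^-distribˡ-+-* p s t)) (1<p*p^ 1<p K)
  ... | inj₂ (1<p^t , c1≡1) = by-column (classify K) eq T 1<p^t c1≡1
  ... | inj₁ (1<p^s , r1≡1) = fromWord-swap (by-column (classify K) (trans (+-comm t s) eq) (swap T) 1<p^s r1≡1)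

module WordTilings (p : ℕ) (1<p : 1 < p) where

  instance
    p≢0 : NonZero p
    p≢0 = >-nonZero (<-trans z<s 1<p)

  open Euclid p
  open Words p

  refine-digit : ∀ g {q t} → t < p → refine g (p * q + t) ≡ p * g q + t
  refine-digit g t<p = cong₂ (λ q t → p * g q + t) ([p*q+t]/p≡q t<p) ([p*q+t]%p≡t t<p)

  refine-columns : ∀ {nA nB f g} → Tiling nA nB f g → Tiling nA (p * nB) (scale f) (refine g)
  refine-columns {nA} {nB} {f} {g} T = record
    { r-zero = trans (cong (p *_) r-zero) (*-zeroʳ p)
    ; c-zero = trans (cong₂ (λ q t → p * g q + t) (0/n≡0 p) (m<n⇒m%n≡m (>-nonZero⁻¹ p)))
        (trans (+-identityʳ _) (trans (cong (p *_) c-zero) (*-zeroʳ p)))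
    ; r-increasing = λ i<i' i'< → *-monoʳ-< p (r-increasing i<i' i'<)
    ; c-increasing = increasing
    ; sum-bounded = λ {i} {j} i< j< → subst₂ _<_ (regroup i j) (ring nA nB)
        (p*q+t<p*q'+t' {t' = 0} (m%n<n j p) (sum-bounded i< (quot< j<)))
    ; sum-injective = λ {i} {j} {i'} {j'} i< j< i'< j'< eq → sum-injective i< (quot< j<) i'< (quot< j'<)
        (quotient-unique (m%n<n j p) (m%n<n j' p) (trans (regroup i j) (trans eq (sym (regroup i' j')))))
    ; sum-surjective = surjective
    }
    where
    open Tiling T
    ring : ∀ a b → p * (a * b) + 0 ≡ a * (p * b)
    ring a b = trans (+-identityʳ _) (solve-∀′ p a b)
      where
      solve-∀′ : ∀ p a b → p * (a * b) ≡ a * (p * b)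
      solve-∀′ = solve-∀
    regroup : ∀ i j → p * (f i + g (j / p)) + j % p ≡ p * f i + refine g j
    regroup i j = trans (cong (_+ j % p) (*-distribˡ-+ p (f i) _)) (+-assoc (p * f i) _ _)
    quot< : ∀ {j} → j < p * nB → j / p < nB
    quot< {j} j< = m<n*o⇒m/o<n (subst (j <_) (*-comm p nB) j<)
    increasing : StrictlyIncreasingBelow (p * nB) (refine g)
    increasing {j} {j'} j<j' j'< with <-cmp (j / p) (j' / p)
    ... | tri< q<q' _ _ = p*q+t<p*q'+t' (m%n<n j p) (c-increasing q<q' (quot< j'<))
    ... | tri≈ _ q≡q' _ = subst (λ z → p * g z + j % p < refine g j') (sym q≡q')
      (+-monoʳ-< (p * g (j' / p)) (+-cancelˡ-< (p * (j' / p)) _ _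
        (subst₂ _<_ (trans (euclid j) (cong (λ z → p * z + j % p) q≡q')) (euclid j') j<j')))
    ... | tri> _ _ q>q' = ⊥-elim (<⇒≱ q>q' (/-monoˡ-≤ p (<⇒≤ j<j')))
    surjective : ∀ {x} → x < nA * (p * nB) → Cell nA (p * nB) (scale f) (refine g) x
    surjective {x} x< with sum-surjective (m<n*o⇒m/o<n (subst (x <_) (sym (ring′ nA nB p)) x<))
      where
      ring′ : ∀ a b p → a * b * p ≡ a * (p * b)
      ring′ = solve-∀
    ... | cell i q i< q< eq =
      cell i (p * q + x % p) i< (subst (p * q + x % p <_) (+-identityʳ _) (p*q+t<p*q'+t' (m%n<n x p) q<)) (begin
        p * f i + refine g (p * q + x % p) ≡⟨ cong (p * f i +_) (refine-digit g (m%n<n x p)) ⟩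
        p * f i + (p * g q + x % p)        ≡⟨ regroup-digit ⟩
        p * (f i + g q) + x % p            ≡⟨ cong (λ z → p * z + x % p) eq ⟩
        p * (x / p) + x % p                ≡⟨ euclid x ⟨
        x                                  ∎)
      where
      open ≡-Reasoning
      regroup-digit : p * f i + (p * g q + x % p) ≡ p * (f i + g q) + x % p
      regroup-digit = trans (sym (+-assoc (p * f i) _ _)) (cong (_+ x % p) (sym (*-distribˡ-+ p (f i) (g q))))

  identity-tiling : Tiling 1 1 (λ i → i) (λ j → j)
  identity-tiling = record
    { r-zero = refl
    ; c-zero = refl
    ; r-increasing = λ { i<i' (s<s z≤n) → ⊥-elim (n≮0 i<i') }
    ; c-increasing = λ { j<j' (s<s z≤n) → ⊥-elim (n≮0 j<j') }
    ; sum-bounded = λ { (s<s z≤n) (s<s z≤n) → s<s z≤n }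
    ; sum-injective = λ { (s<s z≤n) _ (s<s z≤n) _ _ → refl }
    ; sum-surjective = λ { (s<s z≤n) → cell 0 0 (s<s z≤n) (s<s z≤n) refl }
    }

  word-tiling : ∀ σ → Tiling (p ^ count true σ) (p ^ count false σ) (scatter true σ) (scatter false σ)
  word-tiling [] = identity-tiling
  word-tiling (false ∷ σ) = refine-columns (word-tiling σ)
  word-tiling (true ∷ σ) = swap (refine-columns (swap (word-tiling σ)))

  complement-digits : ∀ {n q t} → q < n → t < p → p * n ∸ suc (p * q + t) ≡ p * (n ∸ suc q) + (p ∸ suc t)
  complement-digits {n} {q} {t} q<n t<p = begin
    p * n ∸ suc (p * q + t)                          ≡⟨ cong (_∸ suc (p * q + t)) pn≡ ⟩
    suc (p * q + t) + (p * d + e) ∸ suc (p * q + t)  ≡⟨ m+n∸m≡n (suc (p * q + t)) (p * d + e) ⟩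
    p * d + e                                        ∎
    where
    open ≡-Reasoning
    d = n ∸ suc q
    e = p ∸ suc t
    pn≡ : p * n ≡ suc (p * q + t) + (p * d + e)
    pn≡ = begin
      p * n                       ≡⟨ cong (p *_) (m+[n∸m]≡n q<n) ⟨
      p * (suc q + d)             ≡⟨ ring₁ p q d ⟩
      p * q + p + p * d           ≡⟨ cong (λ z → p * q + z + p * d) (m+[n∸m]≡n t<p) ⟨
      p * q + (suc t + e) + p * d ≡⟨ ring₂ (p * q) (p * d) t e ⟩
      suc (p * q + t) + (p * d + e) ∎
      where
      ring₁ : ∀ p q d → p * (suc q + d) ≡ p * q + p + p * d
      ring₁ = solve-∀
      ring₂ : ∀ x y t e → x + (suc t + e) + y ≡ suc (x + t) + (y + e)
      ring₂ = solve-∀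

  refine-symmetric : ∀ {n g} → Symmetric n g → Symmetric (p * n) (refine g)
  refine-symmetric {n} {g} g-sym {i} i< = begin
    refine g i + refine g (p * n ∸ suc i)
      ≡⟨ cong₂ (λ x y → refine g x + refine g y) (euclid i)
           (trans (cong (λ z → p * n ∸ suc z) (euclid i)) (complement-digits q<n t<p)) ⟩
    refine g (p * q + t) + refine g (p * (n ∸ suc q) + (p ∸ suc t))
      ≡⟨ cong₂ _+_ (refine-digit g t<p) (refine-digit g (∸-monoʳ-< z<s t<p)) ⟩
    (p * g q + t) + (p * g (n ∸ suc q) + (p ∸ suc t))
      ≡⟨ ring p (g q) (g (n ∸ suc q)) t (p ∸ suc t) ⟩
    p * (g q + g (n ∸ suc q)) + (t + (p ∸ suc t))
      ≡⟨ cong₂ (λ x y → p * x + y) (g-sym q<n) (cong (_∸ 1) (m+[n∸m]≡n t<p)) ⟩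
    p * g (n ∸ 1) + (p ∸ 1)
      ≡⟨ refine-digit g (∸-monoʳ-< z<s 0<p) ⟨
    refine g (p * (n ∸ 1) + (p ∸ 1))
      ≡⟨ cong (refine g) top≡ ⟨
    refine g (p * n ∸ 1) ∎
    where
    open ≡-Reasoning
    q = i / p
    t = i % p
    q<n : q < n
    q<n = m<n*o⇒m/o<n (subst (i <_) (*-comm p n) i<)
    t<p : t < p
    t<p = m%n<n i p
    0<p : 0 < p
    0<p = >-nonZero⁻¹ p
    top≡ : p * n ∸ 1 ≡ p * (n ∸ 1) + (p ∸ 1)
    top≡ = trans (cong (λ z → p * n ∸ suc z) (sym (trans (+-identityʳ (p * 0)) (*-zeroʳ p))))
                 (complement-digits (≤-<-trans z≤n q<n) 0<p)
    ring : ∀ p a b t e → (p * a + t) + (p * b + e) ≡ p * (a + b) + (t + e)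
    ring = solve-∀

  scale-symmetric : ∀ {n g} → Symmetric n g → Symmetric n (scale g)
  scale-symmetric g-sym i< = trans (sym (*-distribˡ-+ p _ _)) (cong (p *_) (g-sym i<))

  scatter-symmetric : ∀ b σ → Symmetric (p ^ count b σ) (scatter b σ)
  scatter-symmetric b [] {zero} _ = refl
  scatter-symmetric b [] {suc _} (s<s ())
  scatter-symmetric true (true ∷ σ) = refine-symmetric {g = scatter true σ} (scatter-symmetric true σ)
  scatter-symmetric true (false ∷ σ) = scale-symmetric {g = scatter true σ} (scatter-symmetric true σ)
  scatter-symmetric false (false ∷ σ) = refine-symmetric {g = scatter false σ} (scatter-symmetric false σ)
  scatter-symmetric false (true ∷ σ) = scale-symmetric {g = scatter false σ} (scatter-symmetric false σ)

  scatter-zero : ∀ b σ → scatter b σ 0 ≡ 0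
  scatter-zero true σ = Tiling.r-zero (word-tiling σ)
  scatter-zero false σ = Tiling.c-zero (word-tiling σ)

  refine-one : ∀ g → g 0 ≡ 0 → refine g 1 ≡ 1
  refine-one g g0≡0 = begin
    p * g (1 / p) + 1 % p ≡⟨ cong₂ (λ q t → p * g q + t) (m<n⇒m/n≡0 1<p) (m<n⇒m%n≡m 1<p) ⟩
    p * g 0 + 1           ≡⟨ cong (λ z → p * z + 1) g0≡0 ⟩
    p * 0 + 1             ≡⟨ cong (_+ 1) (*-zeroʳ p) ⟩
    1                     ∎
    where open ≡-Reasoning

  scatter-one : ∀ b σ → scatter b (b ∷ σ) 1 ≡ 1
  scatter-one true σ = refine-one (scatter true σ) (scatter-zero true σ)
  scatter-one false σ = refine-one (scatter false σ) (scatter-zero false σ)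

  p*x≢1 : ∀ x → p * x ≢ 1
  p*x≢1 x eq = <⇒≢ 1<p (sym (m*n≡1⇒m≡1 p x eq))

  refine-agree⁻ : ∀ {n g g'} → AgreeBelow (p * n) (refine g) (refine g') → AgreeBelow n g g'
  refine-agree⁻ {n} {g} {g'} agree {i} i< = quotient-unique 0<p 0<p (begin
    p * g i + 0          ≡⟨ refine-digit g 0<p ⟨
    refine g (p * i + 0)  ≡⟨ agree (subst (p * i + 0 <_) (+-identityʳ (p * n)) (p*q+t<p*q'+t' 0<p i<)) ⟩
    refine g' (p * i + 0) ≡⟨ refine-digit g' 0<p ⟩
    p * g' i + 0         ∎)
    where
    open ≡-Reasoning
    0<p : 0 < p
    0<p = >-nonZero⁻¹ p

  scale-agree⁻ : ∀ {n g g'} → AgreeBelow n (scale g) (scale g') → AgreeBelow n g g'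
  scale-agree⁻ agree i< = *-cancelˡ-≡ _ _ p (agree i<)

  word-injective : ∀ σ σ' → count true σ ≡ count true σ' → count false σ ≡ count false σ' →
    AgreeBelow (p ^ count true σ) (scatter true σ) (scatter true σ') →
    AgreeBelow (p ^ count false σ) (scatter false σ) (scatter false σ') → σ ≡ σ'
  word-injective [] [] _ _ _ _ = refl
  word-injective [] (true ∷ σ') () _ _ _
  word-injective [] (false ∷ σ') _ () _ _
  word-injective (true ∷ σ) [] () _ _ _
  word-injective (false ∷ σ) [] _ () _ _
  word-injective (true ∷ σ) (true ∷ σ') #r #c rows cols =
    cong (true ∷_) (word-injective σ σ' (suc-injective #r) #c (refine-agree⁻ rows) (scale-agree⁻ cols))
  word-injective (false ∷ σ) (false ∷ σ') #r #c rows cols =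
    cong (false ∷_) (word-injective σ σ' #r (suc-injective #c) (scale-agree⁻ rows) (refine-agree⁻ cols))
  word-injective (true ∷ σ) (false ∷ σ') _ _ rows _ =
    ⊥-elim (p*x≢1 (scatter true σ' 1) (trans (sym (rows (1<p*p^ 1<p (count true σ)))) (scatter-one true σ)))
  word-injective (false ∷ σ) (true ∷ σ') _ _ _ cols =
    ⊥-elim (p*x≢1 (scatter false σ' 1) (trans (sym (cols (1<p*p^ 1<p (count false σ)))) (scatter-one false σ)))

words : ℕ → ℕ → List (List Bool)
words zero zero = [] ∷ []
words zero (suc k) = []
words (suc L) zero = map (false ∷_) (words L zero)
words (suc L) (suc k) = map (false ∷_) (words L (suc k)) ++ map (true ∷_) (words L k)

nC0≡1 : ∀ n → n C 0 ≡ 1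
nC0≡1 n = trans (nCk≡nC[n∸k] {0} {n} z≤n) (nCn≡1 n)

length-words : ∀ L k → length (words L k) ≡ L C k
length-words zero zero = refl
length-words zero (suc k) = refl
length-words (suc L) zero = begin
  length (map (false ∷_) (words L zero)) ≡⟨ length-map (false ∷_) (words L zero) ⟩
  length (words L zero)                  ≡⟨ length-words L zero ⟩
  L C 0                                  ≡⟨ trans (nC0≡1 L) (sym (nC0≡1 (suc L))) ⟩
  suc L C 0                              ∎
  where open ≡-Reasoning
length-words (suc L) (suc k) = begin
  length (map (false ∷_) (words L (suc k)) ++ map (true ∷_) (words L k))
    ≡⟨ length-++ (map (false ∷_) (words L (suc k))) ⟩
  length (map (false ∷_) (words L (suc k))) + length (map (true ∷_) (words L k))
    ≡⟨ cong₂ _+_ (length-map (false ∷_) (words L (suc k))) (length-map (true ∷_) (words L k)) ⟩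
  length (words L (suc k)) + length (words L k)
    ≡⟨ cong₂ _+_ (length-words L (suc k)) (length-words L k) ⟩
  L C suc k + L C k
    ≡⟨ +-comm (L C suc k) (L C k) ⟩
  L C k + L C suc k
    ≡⟨ nCk+nC[k+1]≡[n+1]C[k+1] L k ⟩
  suc L C suc k ∎
  where open ≡-Reasoning

∈words⇒ : ∀ L k {σ} → σ ∈ words L k → count true σ ≡ k × count true σ + count false σ ≡ L
∈words⇒ zero zero (here refl) = refl , refl
∈words⇒ (suc L) zero σ∈ with ∈-map⁻ (false ∷_) σ∈
... | τ , τ∈ , refl with ∈words⇒ L zero τ∈
...   | #t , #L = #t , trans (+-suc (count true τ) _) (cong suc #L)
∈words⇒ (suc L) (suc k) σ∈ with ∈-++⁻ (map (false ∷_) (words L (suc k))) σ∈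
... | inj₁ σ∈₁ with ∈-map⁻ (false ∷_) σ∈₁
...   | τ , τ∈ , refl with ∈words⇒ L (suc k) τ∈
...     | #t , #L = #t , trans (+-suc (count true τ) _) (cong suc #L)
∈words⇒ (suc L) (suc k) σ∈ | inj₂ σ∈₂ with ∈-map⁻ (true ∷_) σ∈₂
...   | τ , τ∈ , refl with ∈words⇒ L k τ∈
...     | #t , #L = cong suc #t , cong suc #L

∈words : ∀ σ → σ ∈ words (count true σ + count false σ) (count true σ)
∈words [] = here refl
∈words (true ∷ σ) =
  ∈-++⁺ʳ (map (false ∷_) (words (count true σ + count false σ) (suc (count true σ)))) (∈-map⁺ (true ∷_) (∈words σ))
∈words (false ∷ σ) rewrite +-suc (count true σ) (count false σ) = prepend-false (count true σ) (∈words σ)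
  where
  prepend-false : ∀ {L} k → σ ∈ words L k → (false ∷ σ) ∈ words (suc L) k
  prepend-false zero σ∈ = ∈-map⁺ (false ∷_) σ∈
  prepend-false (suc k) σ∈ = ∈-++⁺ˡ (∈-map⁺ (false ∷_) σ∈)

words-unique : ∀ L k → Unique (words L k)
words-unique zero zero = [] ∷ []
words-unique zero (suc k) = []
words-unique (suc L) zero = Unique.map⁺ ∷-injectiveʳ (words-unique L zero)
words-unique (suc L) (suc k) =
  ++⁺ (Unique.map⁺ ∷-injectiveʳ (words-unique L (suc k))) (Unique.map⁺ ∷-injectiveʳ (words-unique L k)) disjoint
  where
  disjoint : ∀ {σ} → ¬ (σ ∈ map (false ∷_) (words L (suc k)) × σ ∈ map (true ∷_) (words L k))
  disjoint (σ∈₁ , σ∈₂) with ∈-map⁻ (false ∷_) σ∈₁ | ∈-map⁻ (true ∷_) σ∈₂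
  ... | _ , _ , refl | _ , _ , ()

Unique-map⁺ : ∀ {A B : Set} (f : A → B) {xs : List A} →
              (∀ {x y} → x ∈ xs → y ∈ xs → f x ≡ f y → x ≡ y) → Unique xs → Unique (map f xs)
Unique-map⁺ f {[]} _ [] = []
Unique-map⁺ f {x ∷ xs} f-inj (x∉xs ∷ xs!) =
  All.map⁺ (All.tabulate λ y∈ fx≡fy → All.lookup x∉xs y∈ (f-inj (here refl) (there y∈) fx≡fy))
  ∷ Unique-map⁺ f (λ x∈ y∈ → f-inj (there x∈) (there y∈)) xs!

-- A section g of f is injective; if f identified x ≢ x', one of them would be missed by g,
-- and punching it out would inject Fin (suc N) into Fin N.
surjective⇒injective : ∀ {N} (f : Fin N → Fin N) → (∀ y → ∃[ x ] f x ≡ y) →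
                       ∀ {x x'} → f x ≡ f x' → x ≡ x'
surjective⇒injective {suc N} f f-surj {x} {x'} fx≡fx' with x ≟ᶠ x'
... | yes x≡x' = x≡x'
... | no x≢x' = ⊥-elim (1+n≰n (injective⇒≤ {f = λ y → punchOut (missed-by-g y)} punchOut∘g-injective))
  where
  g : Fin (suc N) → Fin (suc N)
  g y = proj₁ (f-surj y)
  f∘g : ∀ y → f (g y) ≡ y
  f∘g y = proj₂ (f-surj y)
  missed : Fin (suc N)
  missed with g (f x) ≟ᶠ x
  ... | yes _ = x'
  ... | no _ = x
  returns : ∀ {z y} → z ≡ g y → g (f z) ≡ z
  returns {z} {y} z≡gy = trans (cong g (trans (cong f z≡gy) (f∘g y))) (sym z≡gy)
  missed-by-g : ∀ y → missed ≢ g y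
  missed-by-g y with g (f x) ≟ᶠ x
  ... | yes gfx≡x = λ x'≡gy → x≢x' (trans (sym gfx≡x) (trans (cong g fx≡fx') (returns x'≡gy)))
  ... | no gfx≢x = λ x≡gy → gfx≢x (returns x≡gy)
  punchOut∘g-injective : ∀ {y y'} → punchOut (missed-by-g y) ≡ punchOut (missed-by-g y') → y ≡ y'
  punchOut∘g-injective {y} {y'} eq = trans (sym (f∘g y)) (trans (cong f (punchOut-injective (missed-by-g y) (missed-by-g y') eq)) (f∘g y'))

square : ∀ {n} → (ℕ → ℕ) → (ℕ → ℕ) → Mat n
square r c = tabulate λ i → tabulate λ j → r (toℕ i) + c (toℕ j) + 1

entry-square : ∀ {n} r c (i j : Fin n) → entry (square r c) i j ≡ r (toℕ i) + c (toℕ j) + 1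
entry-square r c i j = trans (cong (λ row → lookup row j) (lookup∘tabulate _ i)) (lookup∘tabulate _ j)

Mat-ext : ∀ {n} {M N : Mat n} → (∀ i j → entry M i j ≡ entry N i j) → M ≡ N
Mat-ext {M = M} {N} eq = begin
  M                                        ≡⟨ tabulate∘lookup M ⟨
  tabulate (λ i → lookup M i)              ≡⟨ tabulate-cong (λ i → trans (sym (tabulate∘lookup (lookup M i)))
                                                (trans (tabulate-cong (eq i)) (tabulate∘lookup (lookup N i)))) ⟩
  tabulate (λ i → lookup N i)              ≡⟨ tabulate∘lookup N ⟩
  N                                        ∎
  where open ≡-Reasoning

square-principal : ∀ {n r c} → Tiling n n r c → Symmetric n r → Symmetric n c → c 1 ≡ 1 →
                   IsPrincipalReversibleSquare (square {n} r c)
square-principal {n} {r} {c} T r-sym c-sym c1≡1 =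
  (row-sums , col-sums) , vertex , (bounds , values) , (row-increasing , col-increasing) , normalised
  where
  open Tiling T
  M = square {n} r c
  E = entry-square {n} r c
  ring₁ : ∀ x y z → (x + y + 1) + (x + z + 1) ≡ (x + x) + ((y + z) + 2)
  ring₁ = solve-∀
  row-sum : ∀ i j → entry M i j + entry M i (opposite j) ≡ (r (toℕ i) + r (toℕ i)) + (c (n ∸ 1) + 2)
  row-sum i j = begin
    entry M i j + entry M i (opposite j)
      ≡⟨ cong₂ _+_ (E i j) (trans (E i (opposite j)) (cong (λ z → r (toℕ i) + c z + 1) (opposite-prop j))) ⟩
    (r (toℕ i) + c (toℕ j) + 1) + (r (toℕ i) + c (n ∸ suc (toℕ j)) + 1)
      ≡⟨ ring₁ (r (toℕ i)) (c (toℕ j)) (c (n ∸ suc (toℕ j))) ⟩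
    (r (toℕ i) + r (toℕ i)) + ((c (toℕ j) + c (n ∸ suc (toℕ j))) + 2)
      ≡⟨ cong (λ z → (r (toℕ i) + r (toℕ i)) + (z + 2)) (c-sym (toℕ<n j)) ⟩
    (r (toℕ i) + r (toℕ i)) + (c (n ∸ 1) + 2) ∎
    where open ≡-Reasoning
  col-sum : ∀ i j → entry M i j + entry M (opposite i) j ≡ (c (toℕ j) + c (toℕ j)) + (r (n ∸ 1) + 2)
  col-sum i j = begin
    entry M i j + entry M (opposite i) j
      ≡⟨ cong₂ _+_ (E i j) (trans (E (opposite i) j) (cong (λ z → r z + c (toℕ j) + 1) (opposite-prop i))) ⟩
    (r (toℕ i) + c (toℕ j) + 1) + (r (n ∸ suc (toℕ i)) + c (toℕ j) + 1)
      ≡⟨ ring₂ (c (toℕ j)) (r (toℕ i)) (r (n ∸ suc (toℕ i))) ⟩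
    (c (toℕ j) + c (toℕ j)) + ((r (toℕ i) + r (n ∸ suc (toℕ i))) + 2)
      ≡⟨ cong (λ z → (c (toℕ j) + c (toℕ j)) + (z + 2)) (r-sym (toℕ<n i)) ⟩
    (c (toℕ j) + c (toℕ j)) + (r (n ∸ 1) + 2) ∎
    where
    open ≡-Reasoning
    ring₂ : ∀ x y z → (y + x + 1) + (z + x + 1) ≡ (x + x) + ((y + z) + 2)
    ring₂ = solve-∀
  row-sums : ∀ (i j k : Fin n) → entry M i j + entry M i (opposite j) ≡ entry M i k + entry M i (opposite k)
  row-sums i j k = trans (row-sum i j) (sym (row-sum i k))
  col-sums : ∀ (i j k : Fin n) → entry M i j + entry M (opposite i) j ≡ entry M k j + entry M (opposite k) j
  col-sums i j k = trans (col-sum i j) (sym (col-sum k j))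
  vertex : CondV M
  vertex i j k l = begin
    entry M i j + entry M k l                                       ≡⟨ cong₂ _+_ (E i j) (E k l) ⟩
    (r (toℕ i) + c (toℕ j) + 1) + (r (toℕ k) + c (toℕ l) + 1)       ≡⟨ ring (r (toℕ i)) (c (toℕ j)) (r (toℕ k)) (c (toℕ l)) ⟩
    (r (toℕ i) + c (toℕ l) + 1) + (r (toℕ k) + c (toℕ j) + 1)       ≡⟨ cong₂ _+_ (E i l) (E k j) ⟨
    entry M i l + entry M k j                                       ∎
    where
    open ≡-Reasoning
    ring : ∀ a b c d → (a + b + 1) + (c + d + 1) ≡ (a + d + 1) + (c + b + 1)
    ring = solve-∀
  bounds : ∀ (i j : Fin n) → 1 ≤ entry M i j × entry M i j ≤ n * n
  bounds i j = subst (1 ≤_) (sym (trans (E i j) (+-comm _ 1))) (s≤s z≤n)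
             , subst (_≤ n * n) (sym (trans (E i j) (+-comm _ 1))) (sum-bounded (toℕ<n i) (toℕ<n j))
  values : ∀ v → 1 ≤ v → v ≤ n * n → ∃[ i ] ∃[ j ] entry M i j ≡ v
  values (suc v) _ v< with sum-surjective v<
  ... | cell i j i< j< eq = fromℕ< i< , fromℕ< j< , (begin
    entry M (fromℕ< i<) (fromℕ< j<)                    ≡⟨ E (fromℕ< i<) (fromℕ< j<) ⟩
    r (toℕ (fromℕ< i<)) + c (toℕ (fromℕ< j<)) + 1
      ≡⟨ cong₂ (λ x y → r x + c y + 1) (toℕ-fromℕ< i<) (toℕ-fromℕ< j<) ⟩
    r i + c j + 1                                      ≡⟨ trans (cong (_+ 1) eq) (+-comm v 1) ⟩
    suc v                                              ∎)
    where open ≡-Reasoning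
  row-increasing : ∀ (i j k : Fin n) → toℕ j < toℕ k → entry M i j < entry M i k
  row-increasing i j k j<k = subst₂ _<_ (sym (E i j)) (sym (E i k))
    (+-monoˡ-< 1 (+-monoʳ-< (r (toℕ i)) (c-increasing j<k (toℕ<n k))))
  col-increasing : ∀ (i j k : Fin n) → toℕ i < toℕ k → entry M i j < entry M k j
  col-increasing i j k i<k = subst₂ _<_ (sym (E i j)) (sym (E k j))
    (+-monoˡ-< 1 (+-monoˡ-< (c (toℕ j)) (r-increasing i<k (toℕ<n k))))
  normalised : Normalised M
  normalised i j i≡0 =
      (λ j≡0 → trans (E i j) (cong₂ (λ x y → x + y + 1) (trans (cong r i≡0) r-zero) (trans (cong c j≡0) c-zero)))
    , (λ j≡1 → trans (E i j) (cong₂ (λ x y → x + y + 1) (trans (cong r i≡0) r-zero) (trans (cong c j≡1) c1≡1)))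

extend : ∀ {n} → (Fin n → ℕ) → ℕ → ℕ
extend {n} f i with i <? n
... | yes i<n = f (fromℕ< i<n)
... | no _ = 0

extend-fromℕ< : ∀ {n} (f : Fin n → ℕ) {i} (i<n : i < n) → extend f i ≡ f (fromℕ< i<n)
extend-fromℕ< {n} f {i} i<n with i <? n
... | yes _ = refl
... | no i≮n = ⊥-elim (i≮n i<n)

extend-toℕ : ∀ {n} (f : Fin n → ℕ) (i : Fin n) → extend f (toℕ i) ≡ f i
extend-toℕ f i = trans (extend-fromℕ< f (toℕ<n i)) (cong f (fromℕ<-toℕ i (toℕ<n i)))

record SquareOfTiling {n} (M : Mat n) : Set where
  field
    r c : ℕ → ℕ
    tiling : Tiling n n r c
    c1≡1 : c 1 ≡ 1
    entry≡ : ∀ i j → entry M i j ≡ r (toℕ i) + c (toℕ j) + 1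

-- Condition (V) splits the entries as r i + c j + 1; they are n² distinct values (a surjection
-- of the n² cells onto {1, …, n²} is injective), which is exactly the tiling property.
principal⇒squareOfTiling : ∀ {n} {M : Mat n} → 1 < n → IsPrincipalReversibleSquare M → SquareOfTiling M
principal⇒squareOfTiling {n} {M} 1<n (_ , vertex , (bounds , values) , (row-increasing , col-increasing) , normalised) =
  record { r = r ; c = c ; tiling = T ; c1≡1 = c1≡1 ; entry≡ = entry≡ }
  where
  0<n : 0 < n
  0<n = <-trans z<s 1<n
  0F 1F : Fin n
  0F = fromℕ< 0<n
  1F = fromℕ< 1<n
  M₀₀≡1 : entry M 0F 0F ≡ 1
  M₀₀≡1 = proj₁ (normalised 0F 0F (toℕ-fromℕ< 0<n)) (toℕ-fromℕ< 0<n)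
  M₀₁≡2 : entry M 0F 1F ≡ 2
  M₀₁≡2 = proj₂ (normalised 0F 1F (toℕ-fromℕ< 0<n)) (toℕ-fromℕ< 1<n)
  r c : ℕ → ℕ
  r = extend (λ i → entry M i 0F ∸ 1)
  c = extend (λ j → entry M 0F j ∸ 1)
  r-toℕ : ∀ i → r (toℕ i) + 1 ≡ entry M i 0F
  r-toℕ i = trans (cong (_+ 1) (extend-toℕ _ i)) (m∸n+n≡m (proj₁ (bounds i 0F)))
  c-toℕ : ∀ j → c (toℕ j) + 1 ≡ entry M 0F j
  c-toℕ j = trans (cong (_+ 1) (extend-toℕ _ j)) (m∸n+n≡m (proj₁ (bounds 0F j)))
  entry≡ : ∀ i j → entry M i j ≡ r (toℕ i) + c (toℕ j) + 1
  entry≡ i j = +-cancelʳ-≡ 1 _ _ (begin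
    entry M i j + 1                     ≡⟨ cong (entry M i j +_) M₀₀≡1 ⟨
    entry M i j + entry M 0F 0F         ≡⟨ vertex i j 0F 0F ⟩
    entry M i 0F + entry M 0F j         ≡⟨ cong₂ _+_ (r-toℕ i) (c-toℕ j) ⟨
    (r (toℕ i) + 1) + (c (toℕ j) + 1)   ≡⟨ ring (r (toℕ i)) (c (toℕ j)) ⟩
    r (toℕ i) + c (toℕ j) + 1 + 1       ∎)
    where
    open ≡-Reasoning
    ring : ∀ x y → (x + 1) + (y + 1) ≡ x + y + 1 + 1
    ring = solve-∀
  entry-fromℕ< : ∀ {i j} (i< : i < n) (j< : j < n) → entry M (fromℕ< i<) (fromℕ< j<) ≡ r i + c j + 1
  entry-fromℕ< i< j< = trans (entry≡ _ _) (cong₂ (λ x y → r x + c y + 1) (toℕ-fromℕ< i<) (toℕ-fromℕ< j<))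
  c1≡1 : c 1 ≡ 1
  c1≡1 = trans (extend-fromℕ< _ 1<n) (cong (_∸ 1) M₀₁≡2)
  value : Fin n × Fin n → Fin (n * n)
  value (i , j) = fromℕ< (subst (_≤ n * n) (sym (trans (+-comm 1 _) (m∸n+n≡m (proj₁ (bounds i j))))) (proj₂ (bounds i j)))
  toℕ-value : ∀ i j → toℕ (value (i , j)) ≡ entry M i j ∸ 1
  toℕ-value i j = toℕ-fromℕ< _
  value-surjective : ∀ y → ∃[ k ] value (remQuot n k) ≡ y
  value-surjective y with values (suc (toℕ y)) (s≤s z≤n) (toℕ<n y)
  ... | i , j , eq = combine i j , trans (cong value (remQuot-combine i j)) (toℕ-injective (trans (toℕ-value i j) (cong (_∸ 1) eq)))
  cell-injective : ∀ {i j i' j'} → entry M i j ≡ entry M i' j' → i ≡ i'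
  cell-injective {i} {j} {i'} {j'} eq = proj₁ (combine-injective i j i' j'
    (surjective⇒injective (λ k → value (remQuot n k)) value-surjective (begin
      value (remQuot n (combine i j))   ≡⟨ cong value (remQuot-combine i j) ⟩
      value (i , j)                     ≡⟨ toℕ-injective (trans (toℕ-value i j) (trans (cong (_∸ 1) eq) (sym (toℕ-value i' j')))) ⟩
      value (i' , j')                   ≡⟨ cong value (remQuot-combine i' j') ⟨
      value (remQuot n (combine i' j')) ∎)))
    where open ≡-Reasoning
  r-fromℕ< : ∀ {i} (i< : i < n) → r i + 1 ≡ entry M (fromℕ< i<) 0F
  r-fromℕ< i< = trans (cong (λ z → r z + 1) (sym (toℕ-fromℕ< i<))) (r-toℕ (fromℕ< i<))
  c-fromℕ< : ∀ {j} (j< : j < n) → c j + 1 ≡ entry M 0F (fromℕ< j<)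
  c-fromℕ< j< = trans (cong (λ z → c z + 1) (sym (toℕ-fromℕ< j<))) (c-toℕ (fromℕ< j<))
  T : Tiling n n r c
  T = record
    { r-zero = trans (extend-fromℕ< _ 0<n) (cong (_∸ 1) M₀₀≡1)
    ; c-zero = trans (extend-fromℕ< _ 0<n) (cong (_∸ 1) M₀₀≡1)
    ; r-increasing = λ {i} {i'} i<i' i'< → +-cancelʳ-< 1 _ _ (subst₂ _<_ (sym (r-fromℕ< (<-trans i<i' i'<))) (sym (r-fromℕ< i'<))
        (col-increasing _ 0F _ (subst₂ _<_ (sym (toℕ-fromℕ< (<-trans i<i' i'<))) (sym (toℕ-fromℕ< i'<)) i<i')))
    ; c-increasing = λ {j} {j'} j<j' j'< → +-cancelʳ-< 1 _ _ (subst₂ _<_ (sym (c-fromℕ< (<-trans j<j' j'<))) (sym (c-fromℕ< j'<))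
        (row-increasing 0F _ _ (subst₂ _<_ (sym (toℕ-fromℕ< (<-trans j<j' j'<))) (sym (toℕ-fromℕ< j'<)) j<j')))
    ; sum-bounded = λ i< j< → subst (_≤ n * n) (trans (entry-fromℕ< i< j<) (+-comm _ 1)) (proj₂ (bounds (fromℕ< i<) (fromℕ< j<)))
    ; sum-injective = λ i< j< i'< j'< eq → trans (sym (toℕ-fromℕ< i<)) (trans (cong toℕ (cell-injective
        (trans (entry-fromℕ< i< j<) (trans (cong (_+ 1) eq) (sym (entry-fromℕ< i'< j'<)))))) (toℕ-fromℕ< i'<))
    ; sum-surjective = surjective
    }
    where
    surjective : ∀ {x} → x < n * n → Cell n n r c x
    surjective {x} x< with values (suc x) (s≤s z≤n) x<
    ... | i , j , eq = cell (toℕ i) (toℕ j) (toℕ<n i) (toℕ<n j)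
      (+-cancelʳ-≡ 1 _ _ (trans (sym (entry≡ i j)) (trans eq (+-comm 1 x))))

square-injective : ∀ {n r c r' c'} → 0 < n → r 0 ≡ 0 → c 0 ≡ 0 → r' 0 ≡ 0 → c' 0 ≡ 0 →
                   square {n} r c ≡ square r' c' → AgreeBelow n r r' × AgreeBelow n c c'
square-injective {n} {r} {c} {r'} {c'} 0<n r0 c0 r'0 c'0 eq =
    (λ {i} i< → +-cancelʳ-≡ 0 _ _ (trans (cong (r i +_) (sym c0)) (trans (+-cancelʳ-≡ 1 _ _ (same i< 0<n)) (cong (r' i +_) c'0))))
  , (λ {j} j< → trans (cong (_+ c j) (sym r0)) (trans (+-cancelʳ-≡ 1 _ _ (same 0<n j<)) (cong (_+ c' j) r'0)))
  where
  same : ∀ {i j} (i< : i < n) (j< : j < n) → r i + c j + 1 ≡ r' i + c' j + 1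
  same {i} {j} i< j< = begin
    r i + c j + 1 ≡⟨ cong₂ (λ x y → r x + c y + 1) (toℕ-fromℕ< i<) (toℕ-fromℕ< j<) ⟨
    r (toℕ (fromℕ< i<)) + c (toℕ (fromℕ< j<)) + 1 ≡⟨ entry-square r c _ _ ⟨
    entry (square r c) (fromℕ< i<) (fromℕ< j<)    ≡⟨ cong (λ M → entry M (fromℕ< i<) (fromℕ< j<)) eq ⟩
    entry (square r' c') (fromℕ< i<) (fromℕ< j<)  ≡⟨ entry-square r' c' _ _ ⟩
    r' (toℕ (fromℕ< i<)) + c' (toℕ (fromℕ< j<)) + 1 ≡⟨ cong₂ (λ x y → r' x + c' y + 1) (toℕ-fromℕ< i<) (toℕ-fromℕ< j<) ⟩
    r' i + c' j + 1 ∎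
    where open ≡-Reasoning

module Counting (p : ℕ) (p-prime : Prime p) (a' : ℕ) where

  open PrimePower p p-prime using (1<p)
  open WordTilings p 1<p
  open Words p
  open Classification p p-prime

  a n : ℕ
  a = suc a'
  n = p ^ a

  principalSquare : List Bool → Mat n
  principalSquare τ = square (scatter true (false ∷ τ)) (scatter false (false ∷ τ))

  candidates : List (List Bool)
  candidates = words (2 * a ∸ 1) a

  2a∸1≡a+a' : 2 * a ∸ 1 ≡ a + a'
  2a∸1≡a+a' = trans (+-suc a' (a' + 0)) (cong (λ z → suc (a' + z)) (+-identityʳ a'))

  counts : ∀ {τ} → τ ∈ candidates → count true τ ≡ a × count false τ ≡ a'
  counts {τ} τ∈ with ∈words⇒ (2 * a ∸ 1) a τ∈
  ... | #t , #L = #t , +-cancelˡ-≡ a _ _ (trans (cong (_+ count false τ) (sym #t)) (trans #L 2a∸1≡a+a'))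

  principalSquare-principal : ∀ {τ} → τ ∈ candidates → IsPrincipalReversibleSquare (principalSquare τ)
  principalSquare-principal {τ} τ∈ with counts τ∈
  ... | #t , #f = square-principal
    (subst₂ (λ s t → Tiling (p ^ s) (p ^ suc t) r c) #t #f (word-tiling (false ∷ τ)))
    (subst (λ s → Symmetric (p ^ s) r) #t (scatter-symmetric true (false ∷ τ)))
    (subst (λ t → Symmetric (p ^ suc t) c) #f (scatter-symmetric false (false ∷ τ)))
    (scatter-one false τ)
    where
    r = scatter true (false ∷ τ)
    c = scatter false (false ∷ τ)

  principalSquare-injective : ∀ {τ τ'} → τ ∈ candidates → τ' ∈ candidates →
                              principalSquare τ ≡ principalSquare τ' → τ ≡ τ'
  principalSquare-injective {τ} {τ'} τ∈ τ'∈ eq with counts τ∈ | counts τ'∈ |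
    square-injective (m^n>0 p a) (scatter-zero true (false ∷ τ)) (scatter-zero false (false ∷ τ))
      (scatter-zero true (false ∷ τ')) (scatter-zero false (false ∷ τ')) eq
  ... | #t , #f | #t' , #f' | rows , cols = ∷-injectiveʳ (word-injective (false ∷ τ) (false ∷ τ')
    (trans #t (sym #t')) (cong suc (trans #f (sym #f')))
    (λ i< → rows (subst (λ s → _ < p ^ s) #t i<))
    (λ j< → cols (subst (λ t → _ < p ^ suc t) #f j<)))

  fromWord-principal : ∀ {M : Mat n} {r c} → FromWord a a r c → c 1 ≡ 1 →
    (∀ i j → entry M i j ≡ r (toℕ i) + c (toℕ j) + 1) → M ∈ map principalSquare candidates
  fromWord-principal record { word = [] ; #cols = () }
  fromWord-principal record { word = true ∷ σ ; c≡ = c≡ } c1≡1 _ =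
    ⊥-elim (p*x≢1 (scatter false σ 1) (trans (sym (c≡ (1<p*p^ 1<p a'))) c1≡1))
  fromWord-principal {M} {r} {c} record { word = false ∷ τ ; #rows = #t ; #cols = #f ; r≡ = r≡ ; c≡ = c≡ } _ M≡ =
    subst (_∈ map principalSquare candidates) (sym M≡square) (∈-map⁺ principalSquare τ∈)
    where
    τ∈ : τ ∈ candidates
    τ∈ = subst₂ (λ L k → τ ∈ words L k) (trans (cong₂ _+_ #t (suc-injective #f)) (sym 2a∸1≡a+a')) #t (∈words τ)
    M≡square : M ≡ principalSquare τ
    M≡square = Mat-ext λ i j → trans (M≡ i j) (trans
      (cong₂ (λ x y → x + y + 1) (r≡ (toℕ<n i)) (c≡ (toℕ<n j)))
      (sym (entry-square (scatter true (false ∷ τ)) (scatter false (false ∷ τ)) i j)))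

  principal∈ : ∀ {M : Mat n} → IsPrincipalReversibleSquare M → M ∈ map principalSquare candidates
  principal∈ {M} prs = fromWord-principal (classify (a + a) refl tiling) c1≡1 entry≡
    where open SquareOfTiling (principal⇒squareOfTiling {M = M} (1<p*p^ 1<p a') prs)

corollary28 : ∀ (p a : ℕ) → Prime p → 1 ≤ a →
    NumPRS≡ (p ^ a) ((2 * a ∸ 1) C a)
corollary28 p (suc a') p-prime _ =
    map principalSquare candidates
  , Unique-map⁺ principalSquare principalSquare-injective (words-unique (2 * a ∸ 1) a)
  , All.map⁺ (All.tabulate principalSquare-principal)
  , (λ _ → principal∈)
  , trans (length-map principalSquare candidates) (length-words (2 * a ∸ 1) a)
  where open Counting p p-prime a'
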